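{- Let $G^*$ be a graph with maximum degree $d$, and let $G$ be a graph of minimum order such that $G^*$ is a blow-up of $G$. Then $G$ has no pair of twins both of which have degree $d$ in $G$.
   Context: All graphs are finite and simple. For a graph $G$ with vertices $v_1,\ldots,v_n$ and graphs $H_1,\ldots,H_n$, the composition $G[H_1,\ldots,H_n]$ is the graph whose vertex set is the disjoint union of the $V(H_i)$, in which $uv$ is an edge iff either $uv \in E(H_i)$ for some $i$, or $u \in V(H_i)$, $v \in V(H_j)$ for distinct $i,j$ with $v_iv_j \in E(G)$. If every $H_i$ is a complete graph or an edgeless graph on at least one vertex, this is a blow-up of $G$. Two distinct vertices $u,v$ are twins if $N(u)\setminus\{v\} = N(v)\setminus\{u\}$ (they may be adjacent or not). -}

module Defs where

open import Data.Nat using (ℕ; _≤_; _≡ᵇ_)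
open import Data.Bool using (Bool; true; false; if_then_else_; _∧_; not)
open import Data.Fin using (Fin; toℕ; _≟_)
open import Data.List using (length; filterᵇ; allFin)
open import Data.Product using (Σ; ∃; ∃-syntax; _×_; _,_)
open import Function using (_∘_)
open import Function.Bundles using (_⤖_; Bijection)
open import Relation.Nullary using (¬_; does)
open import Relation.Binary.PropositionalEquality using (_≡_)

record Graph (n : ℕ) : Set where
  field
    adj    : Fin n → Fin n → Bool
    sym    : ∀ u v → adj u v ≡ adj v u
    irrefl : ∀ v → adj v v ≡ false
open Graph public

deg : ∀ {n} → Graph n → Fin n → ℕ
deg {n} G v = length (filterᵇ (adj G v) (allFin n))

MaxDegree : ∀ {n} → Graph n → ℕ → Set
MaxDegree {n} G d = (∀ v → deg G v ≤ d) × (∃[ v ] deg G v ≡ d)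

-- Adjacency of the blow-up G[H_1,…,H_n] where H_i has s i vertices and is
-- complete if c i = true, edgeless if c i = false.
-- Vertices are pairs (i , a) with a : Fin (s i).
blowAdj : ∀ {n} → Graph n → (s : Fin n → ℕ) → (c : Fin n → Bool) →
          Σ (Fin n) (Fin ∘ s) → Σ (Fin n) (Fin ∘ s) → Bool
blowAdj G s c (i , a) (j , b) =
  if does (i ≟ j) then c i ∧ not (toℕ a ≡ᵇ toℕ b) else adj G i j

IsBlowUpOf : ∀ {N n} → Graph N → Graph n → Set
IsBlowUpOf {N} {n} H G =
  Σ (Fin n → ℕ) λ s → Σ (Fin n → Bool) λ c →
    (∀ i → 1 ≤ s i) ×
    Σ (Fin N ⤖ Σ (Fin n) (Fin ∘ s)) λ f →
      ∀ u v → adj H u v ≡ blowAdj G s c (Bijection.to f u) (Bijection.to f v)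

Twins : ∀ {n} → Graph n → Fin n → Fin n → Set
Twins G u v = ¬ (u ≡ v) × (∀ w → ¬ (w ≡ u) → ¬ (w ≡ v) → adj G u w ≡ adj G v w)

-- Let u, v be twins of G of degree d, and pick one vertex of G* in each part.
-- If a part adjacent to u had two vertices, the chosen vertex in the part of u
-- would have the d chosen neighbours plus one more, so degree d + 1 in G*; the
-- same happens if the part of u is complete with two vertices. Hence the parts
-- of u and v are singletons or, when uv is not an edge, edgeless; in every case
-- both are of the kind (complete iff uv is an edge) of a merged part. As u and
-- v see the same vertices outside {u, v}, G* is then a blow-up of G - v in
-- which u carries the union of both parts, contradicting the minimality of G.
module Submission where

open import Defs hiding (sym)
open import Data.Nat using (ℕ; zero; suc; _+_; _∸_; _≤_; _<_; z≤n; s≤s; _≡ᵇ_; _<?_; _≤?_)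
open import Data.Nat.Properties
  using (≤-trans; <-≤-trans; ≤-antisym; ≤-pred; ≰⇒>; ≮⇒≥; n≮n; m≤m+n; +-monoʳ-<;
         +-cancelˡ-≡; +-cancelˡ-<; +-identityʳ; m+[n∸m]≡n; <⇒≢)
  renaming (_≟_ to _≟ℕ_)
open import Data.Bool using (Bool; true; false; if_then_else_; _∧_; not)
open import Data.Bool.Properties using (∧-zeroʳ; ∧-identityʳ; T-≡)
open import Data.Fin as Fin using (Fin; toℕ; _≟_; fromℕ<; punchIn; punchOut)
open import Data.Fin.Properties
  using (toℕ-fromℕ<; toℕ<n; toℕ-injective; punchIn-injective; punchInᵢ≢i;
         punchIn-punchOut)
open import Data.List using (List; []; _∷_; length; filterᵇ; allFin)
open import Data.List.Properties using (length-map; length-removeAt′)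
open import Data.List.Membership.Propositional using (_∈_; _─_)
open import Data.List.Membership.Propositional.Properties using (∈-filter⁺; ∈-filter⁻; ∈-allFin)
open import Data.List.Relation.Binary.Subset.Propositional using (_⊆_)
open import Data.List.Relation.Unary.Any using (here; there)
open import Data.List.Relation.Unary.All as All using (All; _∷_)
import Data.List.Relation.Unary.All.Properties as All
open import Data.List.Relation.Unary.AllPairs using (_∷_)
open import Data.List.Relation.Unary.Unique.Propositional using (Unique)
import Data.List.Relation.Unary.Unique.Propositional.Properties as Unique
open import Data.Product using (Σ; ∃; ∃-syntax; _×_; _,_; proj₁; proj₂)
open import Data.Sum using (_⊎_; inj₁; inj₂)
open import Function using (_∘_)
open import Function.Bundles using (_⤖_; Bijection; mk⤖; Surjection; Equivalence)
open import Function.Construct.Composition using (_⤖-∘_)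
open import Function.Consequences.Propositional using (strictlySurjective⇒surjective)
open import Relation.Nullary using (¬_; Dec; yes; no; contradiction)
open import Relation.Nullary.Decidable using (T?; dec-true; dec-false)
open import Relation.Binary.PropositionalEquality
  using (_≡_; _≢_; refl; sym; trans; cong; cong₂; subst; subst₂; module ≡-Reasoning)

open Bijection using (to)

∈-─⁺ : ∀ {A : Set} {x z : A} {ys : List A} (x∈ys : x ∈ ys) → z ∈ ys → z ≢ x → z ∈ ys ─ x∈ys
∈-─⁺ (here refl) (here refl) z≢x = contradiction refl z≢x
∈-─⁺ (here refl) (there z∈ys) _   = z∈ys
∈-─⁺ (there _)   (here z≡y)   _   = here z≡y
∈-─⁺ (there x∈ys) (there z∈ys) z≢x = there (∈-─⁺ x∈ys z∈ys z≢x)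

Unique-⊆⇒length≤ : ∀ {A : Set} {xs ys : List A} → Unique xs → xs ⊆ ys → length xs ≤ length ys
Unique-⊆⇒length≤ {xs = []} _ _ = z≤n
Unique-⊆⇒length≤ {xs = x ∷ xs} {ys} (x∉xs ∷ unique) xs⊆ys =
  subst (suc (length xs) ≤_) (sym (length-removeAt′ ys _))
    (s≤s (Unique-⊆⇒length≤ unique λ z∈xs →
      ∈-─⁺ x∈ys (xs⊆ys (there z∈xs)) (λ { refl → All.lookup x∉xs z∈xs refl })))
  where x∈ys = xs⊆ys (here refl)

+-cancelˡ-≡ᵇ : ∀ m x y → (m + x ≡ᵇ m + y) ≡ (x ≡ᵇ y)
+-cancelˡ-≡ᵇ zero    x y = refl
+-cancelˡ-≡ᵇ (suc m) x y = +-cancelˡ-≡ᵇ m x y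

≢⇒≡ᵇ≡false : ∀ {m n} → m ≢ n → (m ≡ᵇ n) ≡ false
≢⇒≡ᵇ≡false {m} {n} = dec-false (m ≟ℕ n)

Σ-≡-toℕ : ∀ {A : Set} {F : A → ℕ} {i k : A} {a : Fin (F i)} {b : Fin (F k)} →
          i ≡ k → toℕ a ≡ toℕ b → _≡_ {A = Σ A (Fin ∘ F)} (i , a) (k , b)
Σ-≡-toℕ refl a≡b = cong (_ ,_) (toℕ-injective a≡b)

toℕ-Fin1 : ∀ {m} → m ≡ 1 → (a : Fin m) → toℕ a ≡ 0
toℕ-Fin1 refl Fin.zero = refl

adj⇒≢ : ∀ {n} (G : Graph n) {i j} → adj G i j ≡ true → i ≢ j
adj⇒≢ G {i} i~j refl with trans (sym i~j) (irrefl G i)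
... | ()

neighbours : ∀ {n} → Graph n → Fin n → List (Fin n)
neighbours {n} G i = filterᵇ (adj G i) (allFin n)

∈-neighbours⁻ : ∀ {n} (G : Graph n) {i j} → j ∈ neighbours G i → adj G i j ≡ true
∈-neighbours⁻ G {i} j∈ = Equivalence.to T-≡ (proj₂ (∈-filter⁻ (T? ∘ adj G i) {xs = allFin _} j∈))

Unique-neighbours⇒length≤deg : ∀ {n} (G : Graph n) (i : Fin n) {L : List (Fin n)} →
  Unique L → All (λ j → adj G i j ≡ true) L → length L ≤ deg G i
Unique-neighbours⇒length≤deg G i unique adjacent = Unique-⊆⇒length≤ unique λ {j} j∈L →
  ∈-filter⁺ (T? ∘ adj G i) (∈-allFin j) (Equivalence.from T-≡ (All.lookup adjacent j∈L))

removeVertex : ∀ {n} → Graph (suc n) → Fin (suc n) → Graph n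
removeVertex G v = record
  { adj    = λ j k → adj G (punchIn v j) (punchIn v k)
  ; sym    = λ j k → Graph.sym G (punchIn v j) (punchIn v k)
  ; irrefl = λ j → irrefl G (punchIn v j)
  }

blowAdj-samePart : ∀ {n} (G : Graph n) s c i (a b : Fin (s i)) →
                   blowAdj G s c (i , a) (i , b) ≡ c i ∧ not (toℕ a ≡ᵇ toℕ b)
blowAdj-samePart G s c i a b = cong (if_then c i ∧ not (toℕ a ≡ᵇ toℕ b) else adj G i i) (dec-true (i ≟ i) refl)

blowAdj-distinctParts : ∀ {n} (G : Graph n) s c {i j} (a : Fin (s i)) (b : Fin (s j)) → i ≢ j →
                        blowAdj G s c (i , a) (j , b) ≡ adj G i j
blowAdj-distinctParts G s c {i} {j} a b i≢j = cong (if_then _ else adj G i j) (dec-false (i ≟ j) i≢j)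

-- A singleton part counts as both complete and edgeless.
data IsOfKind {n} (s : Fin n → ℕ) (c : Fin n → Bool) (w : Fin n) (e : Bool) : Set where
  kind      : c w ≡ e → IsOfKind s c w e
  singleton : s w ≡ 1 → IsOfKind s c w e

IsOfKind-∧ : ∀ {n} {s : Fin n → ℕ} {c w e} → IsOfKind s c w e → ∀ (a b : Fin (s w)) →
             c w ∧ not (toℕ a ≡ᵇ toℕ b) ≡ e ∧ not (toℕ a ≡ᵇ toℕ b)
IsOfKind-∧ (kind cw≡e) a b = cong (_∧ _) cw≡e
IsOfKind-∧ {c = c} {w} {e} (singleton sw≡1) a b rewrite toℕ-Fin1 sw≡1 a | toℕ-Fin1 sw≡1 b =
  trans (∧-zeroʳ (c w)) (sym (∧-zeroʳ e))

IsBlowUpOf-reindex : ∀ {N n m} {s : Fin n → ℕ} {s′ : Fin m → ℕ}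
  (H : Graph N) (G : Graph n) (c : Fin n → Bool) (G′ : Graph m) (c′ : Fin m → Bool) →
  (∀ j → 1 ≤ s′ j) →
  (f : Fin N ⤖ Σ (Fin n) (Fin ∘ s)) →
  (∀ x y → adj H x y ≡ blowAdj G s c (to f x) (to f y)) →
  (g : Σ (Fin n) (Fin ∘ s) ⤖ Σ (Fin m) (Fin ∘ s′)) →
  (∀ p q → blowAdj G s c p q ≡ blowAdj G′ s′ c′ (to g p) (to g q)) →
  IsBlowUpOf H G′
IsBlowUpOf-reindex {s′ = s′} H G c G′ c′ s′≥1 f adjH g preserves =
  s′ , c′ , s′≥1 , g ⤖-∘ f , λ x y → trans (adjH x y) (preserves _ _)

module BlowUpDegree {N n} (H : Graph N) (G : Graph n) (s : Fin n → ℕ) (c : Fin n → Bool)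
  (s≥1 : ∀ i → 1 ≤ s i) (f : Fin N ⤖ Σ (Fin n) (Fin ∘ s))
  (adjH : ∀ x y → adj H x y ≡ blowAdj G s c (to f x) (to f y)) where

  vertex : Σ (Fin n) (Fin ∘ s) → Fin N
  vertex = Bijection.to⁻ f

  to-vertex : ∀ p → to f (vertex p) ≡ p
  to-vertex = Surjection.to∘to⁻ (Bijection.surjection f)

  vertex-injective : ∀ {p q} → vertex p ≡ vertex q → p ≡ q
  vertex-injective {p} {q} eq = trans (sym (to-vertex p)) (trans (cong (to f) eq) (to-vertex q))

  adj-vertex : ∀ p q → adj H (vertex p) (vertex q) ≡ blowAdj G s c p q
  adj-vertex p q = trans (adjH _ _) (cong₂ (blowAdj G s c) (to-vertex p) (to-vertex q))

  first : ∀ i → Fin (s i)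
  first i = fromℕ< (s≥1 i)

  rep : Fin n → Fin N
  rep i = vertex (i , first i)

  second : ∀ {w} → 2 ≤ s w → Fin N
  second {w} 2≤s = vertex (w , fromℕ< 2≤s)

  second≢rep : ∀ {w} (2≤s : 2 ≤ s w) j → second 2≤s ≢ rep j
  second≢rep 2≤s j eq with
    trans (sym (toℕ-fromℕ< 2≤s)) (trans (cong (toℕ ∘ proj₂) (vertex-injective eq)) (toℕ-fromℕ< (s≥1 j)))
  ... | ()

  adj-rep : ∀ {i j} → adj G i j ≡ true → adj H (rep i) (rep j) ≡ true
  adj-rep {i} {j} i~j =
    trans (adj-vertex _ _) (trans (blowAdj-distinctParts G s c (first i) (first j) (adj⇒≢ G i~j)) i~j)

  deg<deg-rep : ∀ i x → adj H (rep i) x ≡ true → (∀ j → x ≢ rep j) → deg G i < deg H (rep i)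
  deg<deg-rep i x rep~x x∉reps =
    subst (_≤ deg H (rep i)) (cong suc (length-map rep (neighbours G i)))
      (Unique-neighbours⇒length≤deg H (rep i)
        (All.map⁺ (All.tabulate (λ {j} _ → x∉reps j)) ∷
           Unique.map⁺ (cong proj₁ ∘ vertex-injective) (Unique.filter⁺ (T? ∘ adj G i) (Unique.allFin⁺ n)))
        (rep~x ∷ All.map⁺ (All.tabulate (adj-rep ∘ ∈-neighbours⁻ G))))

  deg<deg-rep-neighbourPart : ∀ {i w} → adj G i w ≡ true → 2 ≤ s w → deg G i < deg H (rep i)
  deg<deg-rep-neighbourPart {i} i~w 2≤s = deg<deg-rep i (second 2≤s)
    (trans (adj-vertex _ _) (trans (blowAdj-distinctParts G s c (first i) (fromℕ< 2≤s) (adj⇒≢ G i~w)) i~w))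
    (second≢rep 2≤s)

  deg<deg-rep-completePart : ∀ {i} → c i ≡ true → 2 ≤ s i → deg G i < deg H (rep i)
  deg<deg-rep-completePart {i} cᵢ 2≤s = deg<deg-rep i (second 2≤s) rep~second (second≢rep 2≤s)
    where
    rep~second : adj H (rep i) (second 2≤s) ≡ true
    rep~second = begin
      adj H (rep i) (second 2≤s)
        ≡⟨ adj-vertex _ _ ⟩
      blowAdj G s c (i , first i) (i , fromℕ< 2≤s)
        ≡⟨ blowAdj-samePart G s c i (first i) (fromℕ< 2≤s) ⟩
      c i ∧ not (toℕ (first i) ≡ᵇ toℕ (fromℕ< 2≤s))
        ≡⟨ cong₂ (λ a b → c i ∧ not (a ≡ᵇ b)) (toℕ-fromℕ< (s≥1 i)) (toℕ-fromℕ< 2≤s) ⟩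
      c i ∧ true
        ≡⟨ ∧-identityʳ (c i) ⟩
      c i
        ≡⟨ cᵢ ⟩
      true ∎
      where open ≡-Reasoning

  ¬deg<deg-rep : ∀ {d} → (∀ x → deg H x ≤ d) → ∀ {i} → deg G i ≡ d → ¬ deg G i < deg H (rep i)
  ¬deg<deg-rep deg≤d {i} refl lt = n≮n _ (<-≤-trans lt (deg≤d (rep i)))

  maxDegreePart-IsOfKind : ∀ {d} → (∀ x → deg H x ≤ d) → ∀ u v → deg G u ≡ d → deg G v ≡ d →
                           IsOfKind s c u (adj G u v)
  maxDegreePart-IsOfKind deg≤d u v du dv with 2 ≤? s u | adj G u v in u~v | c u in cᵤ
  ... | no 2≰s  | _     | _     = singleton (≤-antisym (≤-pred (≰⇒> 2≰s)) (s≥1 u))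
  ... | yes 2≤s | true  | _     =
    contradiction (deg<deg-rep-neighbourPart (trans (Graph.sym G v u) u~v) 2≤s) (¬deg<deg-rep deg≤d dv)
  ... | yes 2≤s | false | true  = contradiction (deg<deg-rep-completePart cᵤ 2≤s) (¬deg<deg-rep deg≤d du)
  ... | yes _   | false | false = kind cᵤ

module MergeTwins {n} (G : Graph (suc n)) (s : Fin (suc n) → ℕ) (c : Fin (suc n) → Bool)
  (s≥1 : ∀ i → 1 ≤ s i) {u v : Fin (suc n)} (v≢u : v ≢ u)
  (twins : ∀ w → w ≢ u → w ≢ v → adj G u w ≡ adj G v w)
  (u-ofKind : IsOfKind s c u (adj G u v)) (v-ofKind : IsOfKind s c v (adj G u v)) where

  G′ : Graph n
  G′ = removeVertex G v

  -- The part of u′ (the index of u in G - v) lists the part of u, then the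
  -- part of v; position i a is the index of (i , a) inside its new part.
  u′ : Fin n
  u′ = punchOut v≢u

  π : Fin (suc n) → Fin n
  π i with i ≟ v
  ... | yes _   = u′
  ... | no i≢v = punchOut (i≢v ∘ sym)

  σ : Fin (suc n) → Fin (suc n)
  σ i = punchIn v (π i)

  π-v : π v ≡ u′
  π-v with v ≟ v
  ... | yes _   = refl
  ... | no v≢v = contradiction refl v≢v

  σ-v : σ v ≡ u
  σ-v = trans (cong (punchIn v) π-v) (punchIn-punchOut v≢u)

  σ-≢v : ∀ {i} → i ≢ v → σ i ≡ i
  σ-≢v {i} i≢v with i ≟ v
  ... | yes i≡v = contradiction i≡v i≢v
  ... | no i≢v′ = punchIn-punchOut (i≢v′ ∘ sym)

  π-punchIn : ∀ j → π (punchIn v j) ≡ j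
  π-punchIn j = punchIn-injective v _ _ (σ-≢v (punchInᵢ≢i v j))

  π-collision : ∀ {i k} → i ≢ k → π i ≡ π k → (i ≡ u × k ≡ v) ⊎ (i ≡ v × k ≡ u)
  π-collision {i} {k} i≢k πi≡πk = cases (i ≟ v) (k ≟ v)
    where
    σi≡σk : σ i ≡ σ k
    σi≡σk = cong (punchIn v) πi≡πk
    cases : Dec (i ≡ v) → Dec (k ≡ v) → (i ≡ u × k ≡ v) ⊎ (i ≡ v × k ≡ u)
    cases (yes refl) (yes refl) = contradiction refl i≢k
    cases (yes refl) (no k≢v)   = inj₂ (refl , trans (sym (σ-≢v k≢v)) (trans (sym σi≡σk) σ-v))
    cases (no i≢v)   (yes refl) = inj₁ (trans (sym (σ-≢v i≢v)) (trans σi≡σk σ-v) , refl)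
    cases (no i≢v)   (no k≢v)   = contradiction (trans (sym (σ-≢v i≢v)) (trans σi≡σk (σ-≢v k≢v))) i≢k

  adj-σ : ∀ {i k} → σ i ≢ σ k → adj G i k ≡ adj G (σ i) (σ k)
  adj-σ {i} {k} σi≢σk = cases (i ≟ v) (k ≟ v)
    where
    cases : Dec (i ≡ v) → Dec (k ≡ v) → adj G i k ≡ adj G (σ i) (σ k)
    cases (yes refl) (yes refl) = contradiction refl σi≢σk
    cases (yes refl) (no k≢v) rewrite σ-v | σ-≢v k≢v = sym (twins k (σi≢σk ∘ sym) k≢v)
    cases (no i≢v)  (yes refl) rewrite σ-v | σ-≢v i≢v =
      trans (Graph.sym G i v) (trans (sym (twins i σi≢σk i≢v)) (Graph.sym G u i))
    cases (no i≢v)  (no k≢v) rewrite σ-≢v i≢v | σ-≢v k≢v = refl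

  extra : Fin n → ℕ
  extra j with punchIn v j ≟ u
  ... | yes _ = s v
  ... | no _  = 0

  s′ : Fin n → ℕ
  s′ j = s (punchIn v j) + extra j

  c′ : Fin n → Bool
  c′ j with punchIn v j ≟ u
  ... | yes _ = adj G u v
  ... | no _  = c (punchIn v j)

  s′-≡ : ∀ {j} → punchIn v j ≡ u → s′ j ≡ s u + s v
  s′-≡ {j} eq with punchIn v j ≟ u
  ... | yes _  = cong (λ w → s w + s v) eq
  ... | no  ne = contradiction eq ne

  s′-≢ : ∀ {j} → punchIn v j ≢ u → s′ j ≡ s (punchIn v j)
  s′-≢ {j} ne with punchIn v j ≟ u
  ... | yes eq = contradiction eq ne
  ... | no  _  = +-identityʳ _

  c′-≡ : ∀ {j} → punchIn v j ≡ u → c′ j ≡ adj G u v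
  c′-≡ {j} eq with punchIn v j ≟ u
  ... | yes _  = refl
  ... | no  ne = contradiction eq ne

  c′-≢ : ∀ {j} → punchIn v j ≢ u → c′ j ≡ c (punchIn v j)
  c′-≢ {j} ne with punchIn v j ≟ u
  ... | yes eq = contradiction eq ne
  ... | no  _  = refl

  s′≥1 : ∀ j → 1 ≤ s′ j
  s′≥1 j = ≤-trans (s≥1 (punchIn v j)) (m≤m+n _ _)

  position : (i : Fin (suc n)) → Fin (s i) → ℕ
  position i a with i ≟ v
  ... | yes _ = s u + toℕ a
  ... | no _  = toℕ a

  position-v : ∀ a → position v a ≡ s u + toℕ a
  position-v a with v ≟ v
  ... | yes _   = refl
  ... | no v≢v = contradiction refl v≢v

  position-≢v : ∀ {i} → i ≢ v → ∀ a → position i a ≡ toℕ a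
  position-≢v {i} i≢v a with i ≟ v
  ... | yes i≡v = contradiction i≡v i≢v
  ... | no _    = refl

  position<s′ : ∀ i a → position i a < s′ (π i)
  position<s′ i a = cases (i ≟ v)
    where
    cases : Dec (i ≡ v) → position i a < s′ (π i)
    cases (yes refl) = subst₂ _<_ (sym (position-v a)) (sym (s′-≡ σ-v)) (+-monoʳ-< (s u) (toℕ<n a))
    cases (no i≢v)  = subst₂ _<_ (sym (position-≢v i≢v a)) refl
      (<-≤-trans (subst (toℕ a <_) (cong s (sym (σ-≢v i≢v))) (toℕ<n a)) (m≤m+n (s (σ i)) (extra (π i))))

  merge : Σ (Fin (suc n)) (Fin ∘ s) → Σ (Fin n) (Fin ∘ s′)
  merge (i , a) = π i , fromℕ< (position<s′ i a)

  position-u<position-v : ∀ a b → position u a < position v b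
  position-u<position-v a b = subst₂ _<_ (sym (position-≢v (v≢u ∘ sym) a)) (sym (position-v b))
    (<-≤-trans (toℕ<n a) (m≤m+n (s u) (toℕ b)))

  samePart : ∀ i (a b : Fin (s i)) →
             c i ∧ not (toℕ a ≡ᵇ toℕ b) ≡ c′ (π i) ∧ not (position i a ≡ᵇ position i b)
  samePart i a b = cases (i ≟ v) (i ≟ u)
    where
    cases : Dec (i ≡ v) → Dec (i ≡ u) →
            c i ∧ not (toℕ a ≡ᵇ toℕ b) ≡ c′ (π i) ∧ not (position i a ≡ᵇ position i b)
    cases (yes refl) _
      rewrite position-v a | position-v b | +-cancelˡ-≡ᵇ (s u) (toℕ a) (toℕ b) | c′-≡ σ-v =
      IsOfKind-∧ v-ofKind a b
    cases (no i≢v) (yes refl)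
      rewrite position-≢v i≢v a | position-≢v i≢v b | c′-≡ (σ-≢v i≢v) =
      IsOfKind-∧ u-ofKind a b
    cases (no i≢v) (no i≢u)
      rewrite position-≢v i≢v a | position-≢v i≢v b | c′-≢ (i≢u ∘ trans (sym (σ-≢v i≢v))) | σ-≢v i≢v =
      refl

  mergedParts : ∀ {i k} → i ≢ k → π i ≡ π k → ∀ (a : Fin (s i)) (b : Fin (s k)) →
                adj G i k ≡ c′ (π i) ∧ not (position i a ≡ᵇ position k b)
  mergedParts i≢k πi≡πk a b with π-collision i≢k πi≡πk
  ... | inj₁ (refl , refl)
    rewrite c′-≡ (σ-≢v (v≢u ∘ sym)) | ≢⇒≡ᵇ≡false (<⇒≢ (position-u<position-v a b)) =
    sym (∧-identityʳ _)
  ... | inj₂ (refl , refl)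
    rewrite c′-≡ σ-v | ≢⇒≡ᵇ≡false (<⇒≢ (position-u<position-v b a) ∘ sym) =
    trans (Graph.sym G v u) (sym (∧-identityʳ _))

  merge-preserves-adj : ∀ p q → blowAdj G s c p q ≡ blowAdj G′ s′ c′ (merge p) (merge q)
  merge-preserves-adj (i , a) (k , b)
    rewrite toℕ-fromℕ< (position<s′ i a) | toℕ-fromℕ< (position<s′ k b)
    with i ≟ k | π i ≟ π k
  ... | yes refl | yes _      = samePart i a b
  ... | yes refl | no πi≢πi  = contradiction refl πi≢πi
  ... | no i≢k   | yes πi≡πk = mergedParts i≢k πi≡πk a b
  ... | no _     | no πi≢πk  = adj-σ (πi≢πk ∘ punchIn-injective v _ _)

  position-injective : ∀ i {a b} → position i a ≡ position i b → toℕ a ≡ toℕ b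
  position-injective i {a} {b} eq = cases (i ≟ v)
    where
    cases : Dec (i ≡ v) → toℕ a ≡ toℕ b
    cases (yes refl) = +-cancelˡ-≡ (s u) (toℕ a) (toℕ b) (trans (sym (position-v a)) (trans eq (position-v b)))
    cases (no i≢v)  = trans (sym (position-≢v i≢v a)) (trans eq (position-≢v i≢v b))

  merge-injective : ∀ {p q} → merge p ≡ merge q → p ≡ q
  merge-injective {i , a} {k , b} eq = cases (i ≟ k)
    where
    positions : position i a ≡ position k b
    positions = trans (sym (toℕ-fromℕ< (position<s′ i a)))
                  (trans (cong (toℕ ∘ proj₂) eq) (toℕ-fromℕ< (position<s′ k b)))
    cases : Dec (i ≡ k) → (i , a) ≡ (k , b)
    cases (yes refl) = Σ-≡-toℕ refl (position-injective i positions)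
    cases (no i≢k) with π-collision i≢k (cong proj₁ eq)
    ... | inj₁ (refl , refl) = contradiction positions (<⇒≢ (position-u<position-v a b))
    ... | inj₂ (refl , refl) = contradiction (sym positions) (<⇒≢ (position-u<position-v b a))

  merge-strictlySurjective : ∀ y → ∃ λ x → merge x ≡ y
  merge-strictlySurjective (j , b) with toℕ b <? s (punchIn v j)
  ... | yes b<s = (punchIn v j , fromℕ< b<s) , Σ-≡-toℕ (π-punchIn j) (begin
    toℕ (fromℕ< (position<s′ (punchIn v j) (fromℕ< b<s))) ≡⟨ toℕ-fromℕ< _ ⟩
    position (punchIn v j) (fromℕ< b<s)                   ≡⟨ position-≢v (punchInᵢ≢i v j) _ ⟩
    toℕ (fromℕ< b<s)                                      ≡⟨ toℕ-fromℕ< b<s ⟩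
    toℕ b                                                 ∎)
    where open ≡-Reasoning
  ... | no b≮s = cases (punchIn v j ≟ u)
    where
    cases : Dec (punchIn v j ≡ u) → ∃ λ x → merge x ≡ (j , b)
    cases (no j≢u)  = contradiction (subst (toℕ b <_) (s′-≢ j≢u) (toℕ<n b)) b≮s
    cases (yes j≡u) = (v , fromℕ< b∸sᵤ<sᵥ) , Σ-≡-toℕ (trans π-v u′≡j) (begin
        toℕ (fromℕ< (position<s′ v (fromℕ< b∸sᵤ<sᵥ))) ≡⟨ toℕ-fromℕ< _ ⟩
        position v (fromℕ< b∸sᵤ<sᵥ)                   ≡⟨ position-v _ ⟩
        s u + toℕ (fromℕ< b∸sᵤ<sᵥ)                    ≡⟨ cong (s u +_) (toℕ-fromℕ< b∸sᵤ<sᵥ) ⟩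
        s u + (toℕ b ∸ s u)                           ≡⟨ m+[n∸m]≡n sᵤ≤b ⟩
        toℕ b                                         ∎)
        where
        open ≡-Reasoning
        sᵤ≤b : s u ≤ toℕ b
        sᵤ≤b = subst (_≤ toℕ b) (cong s j≡u) (≮⇒≥ b≮s)
        b∸sᵤ<sᵥ : toℕ b ∸ s u < s v
        b∸sᵤ<sᵥ = +-cancelˡ-< (s u) _ _
          (subst (_< s u + s v) (sym (m+[n∸m]≡n sᵤ≤b)) (subst (toℕ b <_) (s′-≡ j≡u) (toℕ<n b)))
        u′≡j : u′ ≡ j
        u′≡j = punchIn-injective v _ _ (trans (punchIn-punchOut v≢u) (sym j≡u))

  mergeParts : Σ (Fin (suc n)) (Fin ∘ s) ⤖ Σ (Fin n) (Fin ∘ s′)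
  mergeParts = mk⤖ (merge-injective , strictlySurjective⇒surjective merge-strictlySurjective)

  isBlowUpOf-removeVertex : ∀ {N} (H : Graph N) (f : Fin N ⤖ Σ (Fin (suc n)) (Fin ∘ s)) →
    (∀ x y → adj H x y ≡ blowAdj G s c (to f x) (to f y)) → IsBlowUpOf H G′
  isBlowUpOf-removeVertex H f adjH =
    IsBlowUpOf-reindex H G c G′ c′ s′≥1 f adjH mergeParts merge-preserves-adj

lemma4p3 : ∀ {N n} (Gs : Graph N) (d : ℕ) (G : Graph n) →
    MaxDegree Gs d →
    IsBlowUpOf Gs G →
    (∀ {m} (G' : Graph m) → IsBlowUpOf Gs G' → n ≤ m) →
    ¬ (∃[ u ] ∃[ v ] (Twins G u v × deg G u ≡ d × deg G v ≡ d))
lemma4p3 {n = zero} _ _ _ _ _ _ (() , _)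
lemma4p3 {n = suc n} Gs d G (deg≤d , _) (s , c , s≥1 , f , adjGs) minimal (u , v , (u≢v , twins) , du , dv) =
  n≮n n (minimal (removeVertex G v) (isBlowUpOf-removeVertex Gs f adjGs))
  where
  open BlowUpDegree Gs G s c s≥1 f adjGs using (maxDegreePart-IsOfKind)
  open MergeTwins G s c s≥1 (u≢v ∘ sym) twins (maxDegreePart-IsOfKind deg≤d u v du dv)
    (subst (IsOfKind s c v) (Graph.sym G v u) (maxDegreePart-IsOfKind deg≤d v u dv du))
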